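{- Let $\{V_n\}_{n\ge 0}$ be the Fennessey-Larcombe-French sequence, defined by $V_0=1$, $V_1=8$ and, for $n\ge 2$, $$(n-1)n^2 V_n = 8(n-1)(3n^2-n-1)V_{n-1} - 128(n-2)n^2 V_{n-2}.$$ Then the sequence $\{n!\,V_n\}_{n\ge 0}$ is strictly log-convex, that is, for all integers $n\ge 1$, $$n V_n^2 < (n+1)V_{n-1}V_{n+1}.$$
   Context: A real sequence $\{S_n\}$ is strictly log-convex if $S_n^2 < S_{n-1}S_{n+1}$ for all admissible $n$. -}

module Defs where

open import Data.Nat using (ℕ)
open import Data.Integer using (+_)
open import Data.Rational using (ℚ; _/_)

ℕ→ℚ : ℕ → ℚ
ℕ→ℚ n = + n / 1

-- For n ≥ 2 the ratio r n = V (n + 1) / V n satisfies 16 < r n ≤ (16n + 19)/(n + 1).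
-- Both bounds propagate from n to n + 1 because, after eliminating V (n + 2) with the
-- recurrence, (the numerator of) each new bound is a combination of the old bounds
-- with coefficients that are nonnegative polynomials in n. Log-convexity at n + 1 then
-- follows from the identity
--   (n + 2) V n V (n+2) − (n + 1) V (n+1)² = (n + 2) V n (V (n+2) − 16 V (n+1))
--       + V (n+1) ((16n + 19) V n − (n + 1) V (n+1)) + 13 V n V (n+1),
-- whose three terms are nonnegative, the last one strictly.
module Submission where

open import Defs
open import Data.Nat using (ℕ; suc; _∸_; _≤_)
open import Data.Rational using (ℚ; _*_; _-_; _<_; 1ℚ)
open import Relation.Binary.PropositionalEquality using (_≡_)

open import Data.Nat as ℕ using (zero)
import Data.Nat.Properties as ℕP
open import Data.Integer as ℤ using (+_)
import Data.Integer.Properties as ℤP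
open import Data.Rational as ℚ using (0ℚ; _+_; -_; _/_; positive; nonNegative)
import Data.Rational.Properties as ℚP
import Data.Rational.Unnormalised as ℚᵘ
import Data.Rational.Unnormalised.Properties as ℚᵘP
open import Data.Rational.Literals using (fromℤ)
open import Data.Product using (_×_; _,_)
open import Relation.Binary.PropositionalEquality using (refl; sym; trans; cong; subst; subst₂; module ≡-Reasoning)
open import Relation.Nullary using (Dec)
open import Relation.Nullary.Decidable using (dec⇒maybe; from-yes; _×-dec_)
open import Tactic.RingSolver using (solve-∀)
open import Tactic.RingSolver.Core.AlmostCommutativeRing using (AlmostCommutativeRing; fromCommutativeRing)
open import Algebra.Properties.Group ℚP.+-0-group using (//-rightDividesˡ)

ℚ-ring : AlmostCommutativeRing _ _
ℚ-ring = fromCommutativeRing ℚP.+-*-commutativeRing (λ x → dec⇒maybe (0ℚ ℚP.≟ x))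

-- ℕ→ℚ n = + n / 1 is stuck on gcd n 1 for variable n; fromℤ (+ n) is its reduced form.
ℕ→ℚ≡fromℤ : ∀ n → ℕ→ℚ n ≡ fromℤ (+ n)
ℕ→ℚ≡fromℤ n = ℚP.↥p/↧p≡p (fromℤ (+ n))

ℕ→ℚ-+ : ∀ m n → ℕ→ℚ (m ℕ.+ n) ≡ ℕ→ℚ m + ℕ→ℚ n
ℕ→ℚ-+ m n rewrite ℕ→ℚ≡fromℤ (m ℕ.+ n) | ℕ→ℚ≡fromℤ m | ℕ→ℚ≡fromℤ n =
  ℚP.toℚᵘ-injective (ℚᵘP.≃-trans (ℚᵘ.*≡* numerators)
                                  (ℚᵘP.≃-sym (ℚP.toℚᵘ-homo-+ (fromℤ (+ m)) (fromℤ (+ n)))))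
  where
  numerators : + (m ℕ.+ n) ℤ.* + 1 ≡ (+ m ℤ.* + 1 ℤ.+ + n ℤ.* + 1) ℤ.* + 1
  numerators rewrite ℤP.*-identityʳ (+ (m ℕ.+ n)) | ℤP.*-identityʳ (+ m)
                   | ℤP.*-identityʳ (+ n) | ℤP.*-identityʳ (+ m ℤ.+ + n) = ℤP.pos-+ m n

ℕ→ℚ-shift : ∀ k n → ℕ→ℚ (k ℕ.+ n) ≡ ℕ→ℚ n + ℕ→ℚ k
ℕ→ℚ-shift k n = trans (ℕ→ℚ-+ k n) (ℚP.+-comm (ℕ→ℚ k) (ℕ→ℚ n))

ℕ→ℚ-suc : ∀ n → ℕ→ℚ (suc n) ≡ ℕ→ℚ n + 1ℚ
ℕ→ℚ-suc = ℕ→ℚ-shift 1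

ℕ→ℚ-nonNeg : ∀ n → 0ℚ ℚ.≤ ℕ→ℚ n
ℕ→ℚ-nonNeg n = ℚP.nonNegative⁻¹ (ℕ→ℚ n) {{ℚP.normalize-nonNeg n 1}}

ℕ→ℚ-pos : ∀ n → 0ℚ < ℕ→ℚ (suc n)
ℕ→ℚ-pos n = ℚP.positive⁻¹ (ℕ→ℚ (suc n)) {{ℚP.normalize-pos (suc n) 1}}

ℕ→ℚ-mono-≤ : ∀ {m n} → m ≤ n → ℕ→ℚ m ℚ.≤ ℕ→ℚ n
ℕ→ℚ-mono-≤ {m} {n} m≤n = begin
  ℕ→ℚ m                  ≡⟨ sym (ℚP.+-identityʳ (ℕ→ℚ m)) ⟩
  ℕ→ℚ m + 0ℚ             ≤⟨ ℚP.+-monoʳ-≤ (ℕ→ℚ m) (ℕ→ℚ-nonNeg (n ∸ m)) ⟩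
  ℕ→ℚ m + ℕ→ℚ (n ∸ m)    ≡⟨ sym (ℕ→ℚ-+ m (n ∸ m)) ⟩
  ℕ→ℚ (m ℕ.+ (n ∸ m))    ≡⟨ cong ℕ→ℚ (ℕP.m+[n∸m]≡n m≤n) ⟩
  ℕ→ℚ n                  ∎
  where open ℚP.≤-Reasoning

p<q⇒0<q-p : ∀ {p q} → p < q → 0ℚ < q - p
p<q⇒0<q-p {p} {q} p<q = subst (_< q - p) (ℚP.+-inverseʳ p) (ℚP.+-monoˡ-< (- p) p<q)

p≤q⇒0≤q-p : ∀ {p q} → p ℚ.≤ q → 0ℚ ℚ.≤ q - p
p≤q⇒0≤q-p {p} {q} p≤q = subst (ℚ._≤ q - p) (ℚP.+-inverseʳ p) (ℚP.+-monoˡ-≤ (- p) p≤q)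

0<q-p⇒p<q : ∀ {p q} → 0ℚ < q - p → p < q
0<q-p⇒p<q {p} {q} 0<q-p =
  subst₂ _<_ (ℚP.+-identityˡ p) (//-rightDividesˡ p q) (ℚP.+-monoˡ-< p 0<q-p)

0≤q-p⇒p≤q : ∀ {p q} → 0ℚ ℚ.≤ q - p → p ℚ.≤ q
0≤q-p⇒p≤q {p} {q} 0≤q-p =
  subst₂ ℚ._≤_ (ℚP.+-identityˡ p) (//-rightDividesˡ p q) (ℚP.+-monoˡ-≤ p 0≤q-p)

*-pos : ∀ {p q} → 0ℚ < p → 0ℚ < q → 0ℚ < p * q
*-pos {p} {q} 0<p 0<q =
  ℚP.positive⁻¹ (p * q) {{ℚP.pos*pos⇒pos p {{positive 0<p}} q {{positive 0<q}}}}

*-nonNeg : ∀ {p q} → 0ℚ ℚ.≤ p → 0ℚ ℚ.≤ q → 0ℚ ℚ.≤ p * q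
*-nonNeg {p} {q} 0≤p 0≤q =
  ℚP.nonNegative⁻¹ (p * q) {{ℚP.nonNeg*nonNeg⇒nonNeg p {{nonNegative 0≤p}} q {{nonNegative 0≤q}}}}

0<*-cancelˡ : ∀ {p q} → 0ℚ < p → 0ℚ < p * q → 0ℚ < q
0<*-cancelˡ {p} {q} 0<p 0<pq =
  ℚP.*-cancelˡ-<-nonNeg p {{nonNegative (ℚP.<⇒≤ 0<p)}} (subst (_< p * q) (sym (ℚP.*-zeroʳ p)) 0<pq)

0≤*-cancelˡ : ∀ {p q} → 0ℚ < p → 0ℚ ℚ.≤ p * q → 0ℚ ℚ.≤ q
0≤*-cancelˡ {p} {q} 0<p 0≤pq =
  ℚP.*-cancelˡ-≤-pos p {{positive 0<p}} (subst (ℚ._≤ p * q) (sym (ℚP.*-zeroʳ p)) 0≤pq)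

+-shift-pos : ∀ k {t} → 0ℚ ℚ.≤ t → 0ℚ < t + ℕ→ℚ (suc k)
+-shift-pos k 0≤t = ℚP.+-mono-≤-< 0≤t (ℕ→ℚ-pos k)

quadratic-nonNeg : ∀ a b c {t} → 0ℚ ℚ.≤ t → 0ℚ ℚ.≤ ℕ→ℚ a * t * t + ℕ→ℚ b * t + ℕ→ℚ c
quadratic-nonNeg a b c 0≤t =
  ℚP.+-mono-≤ (ℚP.+-mono-≤ (*-nonNeg (*-nonNeg (ℕ→ℚ-nonNeg a) 0≤t) 0≤t)
                           (*-nonNeg (ℕ→ℚ-nonNeg b) 0≤t))
              (ℕ→ℚ-nonNeg c)

linear-solution : ∀ {c v d} e → e * c ≡ 1ℚ → c * v ≡ d → v ≡ e * d
linear-solution {c} {v} {d} e ec≡1 cv≡d = begin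
  v           ≡⟨ sym (ℚP.*-identityˡ v) ⟩
  1ℚ * v      ≡⟨ cong (_* v) (sym ec≡1) ⟩
  e * c * v   ≡⟨ ℚP.*-assoc e c v ⟩
  e * (c * v) ≡⟨ cong (e *_) cv≡d ⟩
  e * d       ∎
  where open ≡-Reasoning

-- Lets a ring-solver identity use the equation p ≡ q: the identity carries the multiple
-- c * (p - q) of its defect as an extra summand.
drop-difference : ∀ {l e p q} c → l ≡ e + c * (p - q) → p ≡ q → l ≡ e
drop-difference {l} {e} {p} c l≡e+c[p-q] refl = begin
  l                ≡⟨ l≡e+c[p-q] ⟩
  e + c * (p - p)  ≡⟨ cong (λ d → e + c * d) (ℚP.+-inverseʳ p) ⟩
  e + c * 0ℚ       ≡⟨ cong (λ d → e + d) (ℚP.*-zeroʳ c) ⟩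
  e + 0ℚ           ≡⟨ ℚP.+-identityʳ e ⟩
  e                ∎
  where open ≡-Reasoning

-- The recurrence for V at index n + 2, with a = n, b = n + 1, c = n + 2 and
-- y = V n, x = V (n + 1), z = V (n + 2).
FLF-relation : ℚ → ℚ → ℚ → ℚ → ℚ → ℚ → Set
FLF-relation a b c y x z =
  b * c * c * z ≡ ℕ→ℚ 8 * b * (ℕ→ℚ 3 * c * c - c - 1ℚ) * x - ℕ→ℚ 128 * a * c * c * y

FLF-recurrence : ℚ → ℚ → ℚ → ℚ → Set
FLF-recurrence u = FLF-relation u (u + 1ℚ) (u + ℕ→ℚ 2)

FLF-recurrence-ℕ→ℚ : ∀ n {y x z} →
  FLF-relation (ℕ→ℚ n) (ℕ→ℚ (suc n)) (ℕ→ℚ (suc (suc n))) y x z → FLF-recurrence (ℕ→ℚ n) y x z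
FLF-recurrence-ℕ→ℚ n {y} {x} {z} =
  subst₂ (λ b c → FLF-relation (ℕ→ℚ n) b c y x z) (ℕ→ℚ-suc n) (ℕ→ℚ-shift 2 n)

RatioBounds : ℚ → ℚ → ℚ → Set
RatioBounds u y x = 0ℚ < y × ℕ→ℚ 16 * y < x × (u + 1ℚ) * x ℚ.≤ (ℕ→ℚ 16 * u + ℕ→ℚ 19) * y

ratioBounds? : ∀ u y x → Dec (RatioBounds u y x)
ratioBounds? u y x = (0ℚ ℚP.<? y) ×-dec (ℕ→ℚ 16 * y ℚP.<? x) ×-dec (_ ℚP.≤? _)

lower-bound-identity : ∀ u y x z →
  (u + 1ℚ) * (u + ℕ→ℚ 2) * (u + ℕ→ℚ 2) * (z - ℕ→ℚ 16 * x)
  ≡ (ℕ→ℚ 8 * (u + 1ℚ) * (ℕ→ℚ 1 * u * u + ℕ→ℚ 3 * u + ℕ→ℚ 1) * (x - ℕ→ℚ 16 * y) + ℕ→ℚ 128 * y)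
    + 1ℚ * ((u + 1ℚ) * (u + ℕ→ℚ 2) * (u + ℕ→ℚ 2) * z
            - (ℕ→ℚ 8 * (u + 1ℚ) * (ℕ→ℚ 3 * (u + ℕ→ℚ 2) * (u + ℕ→ℚ 2) - (u + ℕ→ℚ 2) - 1ℚ) * x
               - ℕ→ℚ 128 * u * (u + ℕ→ℚ 2) * (u + ℕ→ℚ 2) * y))
lower-bound-identity = solve-∀ ℚ-ring

-- The coefficient of y is 24u² + 81u − 38, which is nonnegative only for u ≥ 1;
-- written in u − 2 it has nonnegative coefficients.
upper-bound-identity : ∀ u y x z →
  (u + 1ℚ) * (u + ℕ→ℚ 2) * (u + ℕ→ℚ 2) * ((ℕ→ℚ 16 * (u + 1ℚ) + ℕ→ℚ 19) * x - (u + 1ℚ + 1ℚ) * z)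
  ≡ (u + ℕ→ℚ 2) * ((ℕ→ℚ 8 * u * u + ℕ→ℚ 21 * u + ℕ→ℚ 2)
                     * ((ℕ→ℚ 16 * u + ℕ→ℚ 19) * y - (u + 1ℚ) * x)
                   + (ℕ→ℚ 24 * (u - ℕ→ℚ 2) * (u - ℕ→ℚ 2) + ℕ→ℚ 177 * (u - ℕ→ℚ 2) + ℕ→ℚ 220) * y)
    + (u + ℕ→ℚ 2) * ((ℕ→ℚ 8 * (u + 1ℚ) * (ℕ→ℚ 3 * (u + ℕ→ℚ 2) * (u + ℕ→ℚ 2) - (u + ℕ→ℚ 2) - 1ℚ) * x
                      - ℕ→ℚ 128 * u * (u + ℕ→ℚ 2) * (u + ℕ→ℚ 2) * y)
                     - (u + 1ℚ) * (u + ℕ→ℚ 2) * (u + ℕ→ℚ 2) * z)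
upper-bound-identity = solve-∀ ℚ-ring

log-convexity-identity : ∀ u y x z →
  (u + ℕ→ℚ 2) * y * z - (u + 1ℚ) * x * x
  ≡ (u + ℕ→ℚ 2) * y * (z - ℕ→ℚ 16 * x) + x * ((ℕ→ℚ 16 * u + ℕ→ℚ 19) * y - (u + 1ℚ) * x)
    + ℕ→ℚ 13 * x * y
log-convexity-identity = solve-∀ ℚ-ring

leading-coefficient-pos : ∀ {u} → 0ℚ ℚ.≤ u → 0ℚ < (u + 1ℚ) * (u + ℕ→ℚ 2) * (u + ℕ→ℚ 2)
leading-coefficient-pos 0≤u = *-pos (*-pos (+-shift-pos 0 0≤u) (+-shift-pos 1 0≤u)) (+-shift-pos 1 0≤u)

lower-bound-step : ∀ {u y x z} → 0ℚ ℚ.≤ u → FLF-recurrence u y x z →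
  0ℚ < y → ℕ→ℚ 16 * y < x → ℕ→ℚ 16 * x < z
lower-bound-step {u} {y} {x} {z} 0≤u rec 0<y 16y<x =
  0<q-p⇒p<q (0<*-cancelˡ (leading-coefficient-pos 0≤u)
    (subst (0ℚ <_) (sym (drop-difference 1ℚ (lower-bound-identity u y x z) rec)) 0<combination))
  where
  0<combination : 0ℚ < ℕ→ℚ 8 * (u + 1ℚ) * (ℕ→ℚ 1 * u * u + ℕ→ℚ 3 * u + ℕ→ℚ 1) * (x - ℕ→ℚ 16 * y)
                       + ℕ→ℚ 128 * y
  0<combination = ℚP.+-mono-≤-<
    (*-nonNeg (*-nonNeg (*-nonNeg (ℕ→ℚ-nonNeg 8) (ℚP.<⇒≤ (+-shift-pos 0 0≤u)))
                        (quadratic-nonNeg 1 3 1 0≤u))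
              (ℚP.<⇒≤ (p<q⇒0<q-p 16y<x)))
    (*-pos (ℕ→ℚ-pos 127) 0<y)

upper-bound-step : ∀ {u y x z} → ℕ→ℚ 2 ℚ.≤ u → FLF-recurrence u y x z →
  0ℚ < y → (u + 1ℚ) * x ℚ.≤ (ℕ→ℚ 16 * u + ℕ→ℚ 19) * y →
  (u + 1ℚ + 1ℚ) * z ℚ.≤ (ℕ→ℚ 16 * (u + 1ℚ) + ℕ→ℚ 19) * x
upper-bound-step {u} {y} {x} {z} 2≤u rec 0<y upper =
  0≤q-p⇒p≤q (0≤*-cancelˡ (leading-coefficient-pos 0≤u)
    (subst (0ℚ ℚ.≤_) (sym (drop-difference (u + ℕ→ℚ 2) (upper-bound-identity u y x z) (sym rec))) 0≤combination))
  where
  0≤u : 0ℚ ℚ.≤ u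
  0≤u = ℚP.≤-trans (ℕ→ℚ-nonNeg 2) 2≤u
  0≤combination : 0ℚ ℚ.≤ (u + ℕ→ℚ 2) * ((ℕ→ℚ 8 * u * u + ℕ→ℚ 21 * u + ℕ→ℚ 2)
                                          * ((ℕ→ℚ 16 * u + ℕ→ℚ 19) * y - (u + 1ℚ) * x)
                                        + (ℕ→ℚ 24 * (u - ℕ→ℚ 2) * (u - ℕ→ℚ 2)
                                           + ℕ→ℚ 177 * (u - ℕ→ℚ 2) + ℕ→ℚ 220) * y)
  0≤combination = *-nonNeg (ℚP.<⇒≤ (+-shift-pos 1 0≤u))
    (ℚP.+-mono-≤ (*-nonNeg (quadratic-nonNeg 8 21 2 0≤u) (p≤q⇒0≤q-p upper))
                 (*-nonNeg (quadratic-nonNeg 24 177 220 (p≤q⇒0≤q-p 2≤u)) (ℚP.<⇒≤ 0<y)))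

ratioBounds-step : ∀ {u y x z} → ℕ→ℚ 2 ℚ.≤ u → FLF-recurrence u y x z →
  RatioBounds u y x → RatioBounds (u + 1ℚ) x z
ratioBounds-step 2≤u rec (0<y , 16y<x , upper) =
  ℚP.<-trans (*-pos (ℕ→ℚ-pos 15) 0<y) 16y<x ,
  lower-bound-step (ℚP.≤-trans (ℕ→ℚ-nonNeg 2) 2≤u) rec 0<y 16y<x ,
  upper-bound-step 2≤u rec 0<y upper

ratioBounds⇒log-convex : ∀ {u v y x z} → 0ℚ ℚ.≤ u → RatioBounds u y x → RatioBounds v x z →
  (u + 1ℚ) * x * x < (u + ℕ→ℚ 2) * y * z
ratioBounds⇒log-convex {u} {_} {y} {x} {z} 0≤u (0<y , _ , upper) (0<x , 16x<z , _) =
  0<q-p⇒p<q (subst (0ℚ <_) (sym (log-convexity-identity u y x z))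
    (ℚP.+-mono-<-≤
      (ℚP.+-mono-<-≤ (*-pos (*-pos (+-shift-pos 1 0≤u) 0<y) (p<q⇒0<q-p 16x<z))
                     (*-nonNeg (ℚP.<⇒≤ 0<x) (p≤q⇒0≤q-p upper)))
      (ℚP.<⇒≤ (*-pos (*-pos (ℕ→ℚ-pos 12) 0<x) 0<y))))

module FLF-sequence (V : ℕ → ℚ) (V0 : V 0 ≡ 1ℚ) (V1 : V 1 ≡ ℕ→ℚ 8)
  (rec : ∀ n → FLF-recurrence (ℕ→ℚ n) (V n) (V (suc n)) (V (suc (suc n)))) where

  V2 : V 2 ≡ ℕ→ℚ 144
  V2 = linear-solution (+ 1 / 4) refl (subst₂ (λ y x → FLF-recurrence (ℕ→ℚ 0) y x (V 2)) V0 V1 (rec 0))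

  V3 : V 3 ≡ ℕ→ℚ 2432
  V3 = linear-solution (+ 1 / 18) refl (subst₂ (λ y x → FLF-recurrence (ℕ→ℚ 1) y x (V 3)) V1 V2 (rec 1))

  ratio-bounds : ∀ m → RatioBounds (ℕ→ℚ (2 ℕ.+ m)) (V (2 ℕ.+ m)) (V (3 ℕ.+ m))
  ratio-bounds zero =
    subst₂ (RatioBounds (ℕ→ℚ 2)) (sym V2) (sym V3) (from-yes (ratioBounds? (ℕ→ℚ 2) (ℕ→ℚ 144) (ℕ→ℚ 2432)))
  ratio-bounds (suc m) =
    subst (λ u → RatioBounds u (V (3 ℕ.+ m)) (V (4 ℕ.+ m))) (sym (ℕ→ℚ-suc (2 ℕ.+ m)))
      (ratioBounds-step (ℕ→ℚ-mono-≤ (ℕP.m≤m+n 2 m)) (rec (2 ℕ.+ m)) (ratio-bounds m))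

  log-convex-from-values : ∀ n {a b c} → V (n ∸ 1) ≡ a → V n ≡ b → V (suc n) ≡ c →
    ℕ→ℚ n * b * b < ℕ→ℚ (suc n) * a * c → ℕ→ℚ n * V n * V n < ℕ→ℚ (suc n) * V (n ∸ 1) * V (suc n)
  log-convex-from-values n refl refl refl lt = lt

  log-convex : ∀ n → 1 ≤ n → ℕ→ℚ n * V n * V n < ℕ→ℚ (suc n) * V (n ∸ 1) * V (suc n)
  log-convex 1 _ = log-convex-from-values 1 V0 V1 V2
    (from-yes (ℕ→ℚ 1 * ℕ→ℚ 8 * ℕ→ℚ 8 ℚP.<? ℕ→ℚ 2 * 1ℚ * ℕ→ℚ 144))
  log-convex 2 _ = log-convex-from-values 2 V1 V2 V3
    (from-yes (ℕ→ℚ 2 * ℕ→ℚ 144 * ℕ→ℚ 144 ℚP.<? ℕ→ℚ 3 * ℕ→ℚ 8 * ℕ→ℚ 2432))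
  log-convex (suc (suc (suc m))) _ =
    subst₂ (λ a b → a * V (3 ℕ.+ m) * V (3 ℕ.+ m) < b * V (2 ℕ.+ m) * V (4 ℕ.+ m))
      (sym (ℕ→ℚ-suc (2 ℕ.+ m))) (sym (ℕ→ℚ-shift 2 (2 ℕ.+ m)))
      (ratioBounds⇒log-convex {v = ℕ→ℚ (3 ℕ.+ m)} (ℕ→ℚ-nonNeg (2 ℕ.+ m)) (ratio-bounds m) (ratio-bounds (suc m)))

theorem1p5 : (V : ℕ → ℚ) →
    V 0 ≡ 1ℚ →
    V 1 ≡ ℕ→ℚ 8 →
    (∀ n → ℕ→ℚ (suc n) * ℕ→ℚ (suc (suc n)) * ℕ→ℚ (suc (suc n)) * V (suc (suc n))
           ≡ ℕ→ℚ 8 * ℕ→ℚ (suc n)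
               * (ℕ→ℚ 3 * ℕ→ℚ (suc (suc n)) * ℕ→ℚ (suc (suc n)) - ℕ→ℚ (suc (suc n)) - 1ℚ)
               * V (suc n)
             - ℕ→ℚ 128 * ℕ→ℚ n * ℕ→ℚ (suc (suc n)) * ℕ→ℚ (suc (suc n)) * V n) →
    ∀ n → 1 ≤ n → ℕ→ℚ n * V n * V n < ℕ→ℚ (suc n) * V (n ∸ 1) * V (suc n)
theorem1p5 V V0 V1 rec = FLF-sequence.log-convex V V0 V1 (λ n → FLF-recurrence-ℕ→ℚ n (rec n))
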